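{- Let $G$ be a graph that contains a graph $H$ with maximum degree $d$ as an induced minor. Then there is an induced minor model $f$ of $H$ in $G$ such that for every $v\in V(H)$ the maximum degree of the cluster $G[f(v)]$ is at most $d$.
   Context: An induced minor model of $H$ in $G$ is a function $f:V(H)\to 2^{V(G)}\setminus\{\emptyset\}$ such that (1) $f(u)\cap f(v)=\emptyset$ for $u\ne v$, (2) $G[f(v)]$ is connected for each $v\in V(H)$, and (3) $\{u,v\}\in E(H)$ if and only if some vertex of $f(v)$ is adjacent in $G$ to some vertex of $f(u)$. $G$ contains $H$ as an induced minor iff such a model exists. The induced subgraphs $G[f(v)]$ are called clusters. -}

module Defs where

open import Data.Nat using (ℕ; zero; suc; _≤_; _⊔_)
open import Data.Bool using (Bool; true; false; _∧_)
open import Data.Fin using (Fin)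
open import Data.Fin.Subset using (Subset; _∈_; Empty; Nonempty)
open import Data.List using (List; []; _∷_; allFin; filter; length; foldr; map)
open import Data.Product using (Σ; ∃; _×_; _,_)
open import Relation.Binary.PropositionalEquality using (_≡_; _≢_)
open import Relation.Nullary using (¬_)
open import Data.Bool.Properties using (T?)
open import Function using (_∘_)
open import Data.Empty using (⊥)
open import Data.Unit using (⊤)

record Graph : Set where
  field
    size  : ℕ
    adj   : Fin size → Fin size → Bool
    sym   : ∀ u v → adj u v ≡ adj v u
    irrefl : ∀ v → adj v v ≡ false
open Graph public

Vertex : Graph → Set
Vertex G = Fin (size G)

Adj : (G : Graph) → Vertex G → Vertex G → Set
Adj G u v = adj G u v ≡ true

data WalkIn (G : Graph) (S : Subset (size G)) : Vertex G → Vertex G → Set where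
  here : ∀ {v} → v ∈ S → WalkIn G S v v
  step : ∀ {u w v} → u ∈ S → Adj G u w → WalkIn G S w v → WalkIn G S u v

-- G[S] is connected (S nonempty is required separately by the model definition).
Connected : (G : Graph) → Subset (size G) → Set
Connected G S = ∀ u v → u ∈ S → v ∈ S → WalkIn G S u v

inS : ∀ {n} → Subset n → Fin n → Bool
inS S i = Data.Vec.lookup S i
  where import Data.Vec

degIn : (G : Graph) → Subset (size G) → Vertex G → ℕ
degIn G S v = length (filter (λ u → T? (inS S u ∧ adj G v u)) (allFin (size G)))

deg : (G : Graph) → Vertex G → ℕ
deg G v = length (filter (λ u → T? (adj G v u)) (allFin (size G)))

maxDeg : Graph → ℕ
maxDeg G = foldr _⊔_ 0 (map (deg G) (allFin (size G)))

MaxDegInAtMost : (G : Graph) → Subset (size G) → ℕ → Set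
MaxDegInAtMost G S d = ∀ v → v ∈ S → degIn G S v ≤ d

record InducedMinorModel (H G : Graph) : Set where
  field
    f         : Vertex H → Subset (size G)
    nonempty  : ∀ v → Nonempty (f v)
    disjoint  : ∀ u v → u ≢ v → ∀ x → x ∈ f u → x ∈ f v → ⊥
    connected : ∀ v → Connected G (f v)
    edges⇒    : ∀ u v → Adj H u v → Σ (Vertex G) λ x → Σ (Vertex G) λ y → x ∈ f u × y ∈ f v × Adj G x y
    edges⇐    : ∀ u v → u ≢ v → ∀ x y → x ∈ f u → y ∈ f v → Adj G x y → Adj H u v
open InducedMinorModel public

ContainsInducedMinor : Graph → Graph → Set
ContainsInducedMinor G H = InducedMinorModel H G

module Submission where

-- Take a model of minimal total cluster size. If a vertex x of a cluster C = f v had more than d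
-- neighbours in C, grow a breadth-first tree of G[C] from x: the neighbours of x are its children,
-- and a deepest vertex of each child's subtree is a leaf whose removal leaves C connected. By
-- minimality no such leaf can be dropped, so each is the only contact of C with the cluster of some
-- neighbour w of v, and distinct leaves give distinct w. Hence x has at most deg v ≤ d neighbours in C.

open import Defs renaming (sym to adj-sym)
open import Data.Nat using (ℕ; zero; suc; pred; _+_; _≤_; _<_; _⊔_; _≤′_; z≤n; s≤s; ≤′-refl; ≤′-step)
open import Data.Nat.Properties
  using (≤-refl; ≤-reflexive; ≤-trans; ≤-antisym; ≤-<-trans; <⇒≱; ≮⇒≥; ≤⇒≤′; n≤0⇒n≡0; n≢0⇒n>0; suc-injective
        ; m≤m⊔n; m≤n⊔m; +-mono-≤; +-mono-<-≤; +-mono-≤-<; module ≤-Reasoning)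
  renaming (_≟_ to _≟ℕ_; _<?_ to _<?ℕ_)
open import Data.Bool using (Bool; true; false; _∧_)
open import Data.Bool.Properties using (T?; ∧-conicalˡ; ∧-conicalʳ) renaming (_≟_ to _≟ᵇ_)
open import Data.Fin using (Fin; zero; suc; _≟_)
open import Data.Fin.Properties using (any?; 0≢1+n)
import Data.Fin.Properties as Finₚ
open import Data.Fin.Subset using (Subset; _∈_; _∉_; _⊆_; _-_; ∣_∣; Nonempty; inside; outside)
open import Data.Fin.Subset.Properties using (_∈?_; x∈p⇒∣p-x∣<∣p∣; x∈p∧x≢y⇒x∈p-y; p─q⊆p; p⊆q⇒∣p∣≤∣q∣)
open import Data.Vec as Vec using ([]; _∷_; here; there)
open import Data.Vec.Properties using ([]=⇒lookup; lookup⇒[]=; lookup∘tabulate)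
open import Data.List using (filter; length; tabulate; allFin; foldr; map)
open import Data.List.Membership.Propositional.Properties using (∈-filter⁺; ∈-allFin)
import Data.List.Relation.Unary.All as All
open import Data.List.Relation.Unary.All.Properties using (all-filter)
open import Data.List.Extrema.Nat using (argmax; argmax-all; f[xs]≤f[argmax])
open import Data.Product using (Σ; ∃; _×_; _,_; proj₁; proj₂)
open import Data.Sum using (_⊎_; inj₁; inj₂)
open import Function using (_∘_)
open import Induction.WellFounded using (Acc; acc)
open import Data.Nat.Induction using (<-wellFounded)
open import Relation.Binary.PropositionalEquality
  using (_≡_; _≢_; refl; sym; trans; cong; subst; module ≡-Reasoning)
open import Relation.Nullary using (¬_; Dec; yes; no; contradiction)
open import Relation.Nullary.Decidable using (_×-dec_; _⊎-dec_; ¬?; decidable-stable)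
open import Relation.Unary using (Decidable)

private
  variable
    n m : ℕ

length-filter-tabulate : ∀ {A : Set} (h : Fin n → A) (p : A → Bool) →
  length (filter (T? ∘ p) (tabulate h)) ≡ ∣ Vec.tabulate (p ∘ h) ∣
length-filter-tabulate {zero}  h p = refl
length-filter-tabulate {suc n} h p with p (h zero)
... | true  = cong suc (length-filter-tabulate (h ∘ suc) p)
... | false = length-filter-tabulate (h ∘ suc) p

length-filter-allFin : (p : Fin n → Bool) → length (filter (T? ∘ p) (allFin n)) ≡ ∣ Vec.tabulate p ∣
length-filter-allFin = length-filter-tabulate Function.id

∈-tabulate⁻ : {p : Fin n → Bool} {i : Fin n} → i ∈ Vec.tabulate p → p i ≡ true
∈-tabulate⁻ {p = p} {i} i∈ = trans (sym (lookup∘tabulate p i)) ([]=⇒lookup i∈)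

∈-tabulate⁺ : {p : Fin n → Bool} {i : Fin n} → p i ≡ true → i ∈ Vec.tabulate p
∈-tabulate⁺ {p = p} {i} pi = lookup⇒[]= i _ (trans (lookup∘tabulate p i) pi)

x∉p-x : (p : Subset n) (x : Fin n) → x ∉ p - x
x∉p-x (_ ∷ p) zero    ()
x∉p-x (_ ∷ p) (suc x) (there x∈) = x∉p-x p x x∈

x∈p-y⇒x≢y : {p : Subset n} {x y : Fin n} → x ∈ p - y → x ≢ y
x∈p-y⇒x≢y {p = p} {x} x∈ refl = x∉p-x p x x∈

injection⇒∣p∣≤∣q∣ : {p : Subset m} {q : Subset n} (g : ∀ {i} → i ∈ p → Fin n) →
  (∀ {i} (i∈p : i ∈ p) → g i∈p ∈ q) →
  (∀ {i j} (i∈p : i ∈ p) (j∈p : j ∈ p) → g i∈p ≡ g j∈p → i ≡ j) →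
  ∣ p ∣ ≤ ∣ q ∣
injection⇒∣p∣≤∣q∣ {p = []} g into inj = z≤n
injection⇒∣p∣≤∣q∣ {p = outside ∷ p} g into inj =
  injection⇒∣p∣≤∣q∣ (g ∘ there) (into ∘ there) λ i∈ j∈ e → Finₚ.suc-injective (inj (there i∈) (there j∈) e)
injection⇒∣p∣≤∣q∣ {p = inside ∷ p} {q} g into inj =
  ≤-<-trans ∣p∣≤∣q-g₀∣ (x∈p⇒∣p-x∣<∣p∣ (into here))
  where
  ∣p∣≤∣q-g₀∣ : ∣ p ∣ ≤ ∣ q - g here ∣
  ∣p∣≤∣q-g₀∣ = injection⇒∣p∣≤∣q∣ (g ∘ there)
    (λ i∈ → x∈p∧x≢y⇒x∈p-y (into (there i∈)) (0≢1+n ∘ sym ∘ inj (there i∈) here))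
    (λ i∈ j∈ e → Finₚ.suc-injective (inj (there i∈) (there j∈) e))

∑ : (Fin n → ℕ) → ℕ
∑ {zero}  a = 0
∑ {suc n} a = a zero + ∑ (a ∘ suc)

∑-mono-≤ : (a b : Fin n → ℕ) → (∀ i → a i ≤ b i) → ∑ a ≤ ∑ b
∑-mono-≤ {zero}  a b a≤b = z≤n
∑-mono-≤ {suc n} a b a≤b = +-mono-≤ (a≤b zero) (∑-mono-≤ (a ∘ suc) (b ∘ suc) (a≤b ∘ suc))

∑-mono-< : (a b : Fin n → ℕ) → (∀ i → a i ≤ b i) → ∀ j → a j < b j → ∑ a < ∑ b
∑-mono-< a b a≤b zero    aj<bj = +-mono-<-≤ aj<bj (∑-mono-≤ (a ∘ suc) (b ∘ suc) (a≤b ∘ suc))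
∑-mono-< a b a≤b (suc j) aj<bj = +-mono-≤-< (a≤b zero) (∑-mono-< (a ∘ suc) (b ∘ suc) (a≤b ∘ suc) j aj<bj)

Least : (ℕ → Set) → ℕ → Set
Least P k = P k × (∀ {j} → j < k → ¬ P j)

least : {P : ℕ → Set} → Decidable P → ∀ {n} → P n → ∃ (Least P)
least P? {n} Pn with P? 0
... | yes P0 = 0 , P0 , λ ()
least P? {zero}  P0 | no ¬P0 = contradiction P0 ¬P0
least P? {suc n} Pn | no ¬P0 with least (P? ∘ suc) Pn
... | k , Pk , below = suc k , Pk , λ { {zero} _ → ¬P0 ; {suc j} (s≤s j<k) → below j<k }

module _ {G : Graph} {S : Subset (size G)} where

  walk-head : ∀ {u v} → WalkIn G S u v → u ∈ S
  walk-head (here u∈S)     = u∈S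
  walk-head (step u∈S _ _) = u∈S

  _++ʷ_ : ∀ {u v w} → WalkIn G S u v → WalkIn G S v w → WalkIn G S u w
  here _       ++ʷ q = q
  step u∈S a p ++ʷ q = step u∈S a (p ++ʷ q)

  reverseʷ : ∀ {u v} → WalkIn G S u v → WalkIn G S v u
  reverseʷ (here u∈S)             = here u∈S
  reverseʷ (step {u} {w} u∈S a p) = reverseʷ p ++ʷ step (walk-head p) (trans (adj-sym G w u) a) (here u∈S)

  walks-to⇒Connected : ∀ {x} → (∀ {u} → u ∈ S → WalkIn G S u x) → Connected G S
  walks-to⇒Connected to-x u v u∈S v∈S = to-x u∈S ++ʷ reverseʷ (to-x v∈S)

adj? : (G : Graph) → ∀ u v → Dec (Adj G u v)
adj? G u v = adj G u v ≟ᵇ true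

adj⇒≢ : (G : Graph) {u v : Vertex G} → Adj G u v → u ≢ v
adj⇒≢ G {u} uv refl with () ← trans (sym uv) (irrefl G u)

module BreadthFirstTree (G : Graph) (C : Subset (size G)) (C-connected : Connected G C)
                        {x : Vertex G} (x∈C : x ∈ C) where

  Reach : ℕ → Vertex G → Set
  Reach zero    z = z ≡ x
  Reach (suc k) z = Reach k z ⊎ (z ∈ C × Σ (Vertex G) λ u → Reach k u × Adj G u z)

  reach? : ∀ k z → Dec (Reach k z)
  reach? zero    z = z ≟ x
  reach? (suc k) z = reach? k z ⊎-dec (z ∈? C ×-dec any? λ u → reach? k u ×-dec adj? G u z)

  reach⇒∈ : ∀ {k z} → Reach k z → z ∈ C
  reach⇒∈ {zero}  refl             = x∈C
  reach⇒∈ {suc k} (inj₁ r)         = reach⇒∈ r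
  reach⇒∈ {suc k} (inj₂ (z∈C , _)) = z∈C

  reach-mono′ : ∀ {j k z} → j ≤′ k → Reach j z → Reach k z
  reach-mono′ ≤′-refl       r = r
  reach-mono′ (≤′-step j≤k) r = inj₁ (reach-mono′ j≤k r)

  reach-mono : ∀ {j k z} → j ≤ k → Reach j z → Reach k z
  reach-mono = reach-mono′ ∘ ≤⇒≤′

  reach-along : ∀ {k u z} → WalkIn G C u z → Reach k u → ∃ λ j → Reach j z
  reach-along (here _)     r = _ , r
  reach-along (step _ a w) r = reach-along w (inj₂ (walk-head w , _ , r , a))

  reachable : ∀ {z} → z ∈ C → ∃ λ k → Reach k z
  reachable {z} z∈C = reach-along (C-connected x z x∈C z∈C) refl

  dist : Vertex G → ℕ
  dist z with z ∈? C
  ... | yes z∈C = proj₁ (least (λ k → reach? k z) (proj₂ (reachable z∈C)))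
  ... | no  _   = 0

  dist-least : ∀ {z} → z ∈ C → Least (λ k → Reach k z) (dist z)
  dist-least {z} z∈C with z ∈? C
  ... | yes z∈C′ = proj₂ (least (λ k → reach? k z) (proj₂ (reachable z∈C′)))
  ... | no  z∉C  = contradiction z∈C z∉C

  dist-min : ∀ {k z} → Reach k z → dist z ≤ k
  dist-min r = ≮⇒≥ λ k<dist → proj₂ (dist-least (reach⇒∈ r)) k<dist r

  dist-x : dist x ≡ 0
  dist-x = n≤0⇒n≡0 (dist-min {0} refl)

  dist≡0⇒≡x : ∀ {z} → z ∈ C → dist z ≡ 0 → z ≡ x
  dist≡0⇒≡x z∈C d≡0 = subst (λ k → Reach k _) d≡0 (proj₁ (dist-least z∈C))

  dist-suc : ∀ {z} → z ∈ C → z ≢ x → ∃ λ k → dist z ≡ suc k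
  dist-suc {z} z∈C z≢x with dist z in eq
  ... | zero  = contradiction (dist≡0⇒≡x z∈C eq) z≢x
  ... | suc k = k , refl

  dist-neighbour : ∀ {y} → y ∈ C → Adj G x y → dist y ≡ 1
  dist-neighbour y∈C xy = ≤-antisym (dist-min (inj₂ (y∈C , _ , refl , xy)))
    (n≢0⇒n>0 λ d≡0 → adj⇒≢ G xy (sym (dist≡0⇒≡x y∈C d≡0)))

  IsParent : Vertex G → Vertex G → Set
  IsParent z u = u ∈ C × Adj G z u × suc (dist u) ≡ dist z

  isParent? : ∀ z u → Dec (IsParent z u)
  isParent? z u = u ∈? C ×-dec adj? G z u ×-dec (suc (dist u) ≟ℕ dist z)

  unreached-before-dist : ∀ {z k} → z ∈ C → dist z ≡ suc k → ¬ Reach k z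
  unreached-before-dist z∈C d≡1+k = proj₂ (dist-least z∈C) (subst (_ <_) (sym d≡1+k) ≤-refl)

  -- A predecessor u of z on a shortest walk has dist u ≡ k: a shorter walk to u would give one to z.
  parent-exists : ∀ {z k} → z ∈ C → dist z ≡ suc k → ∃ (IsParent z)
  parent-exists {z} {k} z∈C d≡1+k with subst (λ j → Reach j z) d≡1+k (proj₁ (dist-least z∈C))
  ... | inj₁ r = contradiction r (unreached-before-dist z∈C d≡1+k)
  ... | inj₂ (_ , u , ru , uz) =
    u , reach⇒∈ ru , trans (adj-sym G z u) uz , trans (cong suc du≡k) (sym d≡1+k)
    where
    du≡k : dist u ≡ k
    du≡k = ≤-antisym (dist-min ru) (≮⇒≥ λ du<k → unreached-before-dist z∈C d≡1+k
      (reach-mono du<k (inj₂ (z∈C , u , proj₁ (dist-least (reach⇒∈ ru)) , uz))))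

  parent : Vertex G → Vertex G
  parent z with any? (isParent? z)
  ... | yes (u , _) = u
  ... | no  _       = x

  parent-isParent : ∀ {z} → z ∈ C → z ≢ x → IsParent z (parent z)
  parent-isParent {z} z∈C z≢x with any? (isParent? z)
  ... | yes (_ , p) = p
  ... | no  none    = contradiction (parent-exists z∈C (proj₂ (dist-suc z∈C z≢x))) none

  ancestor : ℕ → Vertex G → Vertex G
  ancestor zero    z = z
  ancestor (suc k) z = ancestor k (parent z)

  -- the child of x whose subtree contains z
  branch : Vertex G → Vertex G
  branch z = ancestor (pred (dist z)) z

  branch-x : branch x ≡ x
  branch-x = cong (λ k → ancestor (pred k) x) dist-x

  branch-neighbour : ∀ {y} → y ∈ C → Adj G x y → branch y ≡ y
  branch-neighbour y∈C xy = cong (λ k → ancestor (pred k) _) (dist-neighbour y∈C xy)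

  branch-parent : ∀ {z} → z ∈ C → z ≢ x → parent z ≢ x → branch z ≡ branch (parent z)
  branch-parent {z} z∈C z≢x pz≢x = begin
    ancestor (pred (dist z)) z                   ≡⟨ cong (λ j → ancestor (pred j) z) (sym dz) ⟩
    ancestor (suc k) z                           ≡⟨ cong (λ j → ancestor (pred j) (parent z)) (sym dpz) ⟩
    ancestor (pred (dist (parent z))) (parent z) ∎
    where
    open ≡-Reasoning
    pz : IsParent z (parent z)
    pz = parent-isParent z∈C z≢x
    k : ℕ
    k = proj₁ (dist-suc (proj₁ pz) pz≢x)
    dpz : dist (parent z) ≡ suc k
    dpz = proj₂ (dist-suc (proj₁ pz) pz≢x)
    dz : suc (suc k) ≡ dist z
    dz = trans (cong suc (sym dpz)) (proj₂ (proj₂ pz))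

  InBranch : Vertex G → Vertex G → Set
  InBranch y z = z ∈ C × branch z ≡ y

  inBranch? : ∀ y z → Dec (InBranch y z)
  inBranch? y z = z ∈? C ×-dec branch z ≟ y

  leaf : Vertex G → Vertex G
  leaf y = argmax dist y (filter (inBranch? y) (allFin (size G)))

  module _ {y : Vertex G} (y∈C : y ∈ C) (xy : Adj G x y) where

    leaf-inBranch : InBranch y (leaf y)
    leaf-inBranch = argmax-all dist (y∈C , branch-neighbour y∈C xy) (all-filter (inBranch? y) (allFin (size G)))

    leaf-deepest : ∀ {z} → InBranch y z → dist z ≤ dist (leaf y)
    leaf-deepest {z} z∈B = All.lookup (f[xs]≤f[argmax] {f = dist} y _)
      (∈-filter⁺ (inBranch? y) (∈-allFin z) z∈B)

    leaf∈C : leaf y ∈ C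
    leaf∈C = proj₁ leaf-inBranch

    leaf≢x : leaf y ≢ x
    leaf≢x ℓ≡x = adj⇒≢ G xy (sym (trans (sym (proj₂ leaf-inBranch)) (trans (cong branch ℓ≡x) branch-x)))

    -- a child c of the leaf would be deeper in the same branch
    leaf-childless : ∀ {c} → c ∈ C → c ≢ x → parent c ≢ leaf y
    leaf-childless {c} c∈C c≢x pc≡ℓ = <⇒≱ deeper (leaf-deepest (c∈C , c-branch))
      where
      pc : IsParent c (parent c)
      pc = parent-isParent c∈C c≢x
      deeper : dist (leaf y) < dist c
      deeper = subst (λ u → suc (dist u) ≤ dist c) pc≡ℓ (≤-reflexive (proj₂ (proj₂ pc)))
      c-branch : branch c ≡ y
      c-branch = trans (branch-parent c∈C c≢x (λ e → leaf≢x (trans (sym pc≡ℓ) e)))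
                       (trans (cong branch pc≡ℓ) (proj₂ leaf-inBranch))

    walk-to-x : ∀ k {z} → z ∈ C → z ≢ leaf y → dist z ≡ k → WalkIn G (C - leaf y) z x
    walk-to-x zero    z∈C z≢ℓ dz≡0 rewrite dist≡0⇒≡x z∈C dz≡0 =
      here (x∈p∧x≢y⇒x∈p-y x∈C (leaf≢x ∘ sym))
    walk-to-x (suc k) {z} z∈C z≢ℓ dz≡1+k =
      step (x∈p∧x≢y⇒x∈p-y z∈C z≢ℓ) (proj₁ (proj₂ pz))
           (walk-to-x k (proj₁ pz) (leaf-childless z∈C z≢x) (suc-injective (trans (proj₂ (proj₂ pz)) dz≡1+k)))
      where
      z≢x : z ≢ x
      z≢x z≡x with () ← trans (sym dz≡1+k) (trans (cong dist z≡x) dist-x)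
      pz : IsParent z (parent z)
      pz = parent-isParent z∈C z≢x

    leaf-nonCut : Connected G (C - leaf y)
    leaf-nonCut = walks-to⇒Connected λ z∈ →
      walk-to-x _ (p─q⊆p C _ z∈) (x∈p-y⇒x≢y z∈) refl

  leaf-injective : ∀ {y y′} → y ∈ C → Adj G x y → y′ ∈ C → Adj G x y′ → leaf y ≡ leaf y′ → y ≡ y′
  leaf-injective y∈C xy y′∈C xy′ ℓ≡ℓ′ =
    trans (sym (proj₂ (leaf-inBranch y∈C xy)))
          (trans (cong branch ℓ≡ℓ′) (proj₂ (leaf-inBranch y′∈C xy′)))

Touches : (G : Graph) → Subset (size G) → Subset (size G) → Set
Touches G A B = Σ (Vertex G) λ a → Σ (Vertex G) λ b → a ∈ A × b ∈ B × Adj G a b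

touches? : (G : Graph) → ∀ A B → Dec (Touches G A B)
touches? G A B = any? λ a → any? λ b → a ∈? A ×-dec b ∈? B ×-dec adj? G a b

Touches-sym : (G : Graph) {A B : Subset (size G)} → Touches G A B → Touches G B A
Touches-sym G (a , b , a∈A , b∈B , ab) = b , a , b∈B , a∈A , trans (adj-sym G b a) ab

weight : {H G : Graph} → InducedMinorModel H G → ℕ
weight M = ∑ λ w → ∣ f M w ∣

module _ {H G : Graph} (M : InducedMinorModel H G) (v : Vertex H) {R : Subset (size G)}
         (R⊆ : R ⊆ f M v) (R≢∅ : Nonempty R) (R-connected : Connected G R)
         (R-touches : ∀ w → Adj H v w → Touches G R (f M w)) where

  cluster : Vertex H → Subset (size G)
  cluster w with v ≟ w
  ... | yes _ = R
  ... | no  _ = f M w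

  cluster-v : cluster v ≡ R
  cluster-v with v ≟ v
  ... | yes _  = refl
  ... | no v≢v = contradiction refl v≢v

  cluster⊆ : ∀ w → cluster w ⊆ f M w
  cluster⊆ w with v ≟ w
  ... | yes refl = R⊆
  ... | no  _    = Function.id

  cluster-nonempty : ∀ w → Nonempty (cluster w)
  cluster-nonempty w with v ≟ w
  ... | yes refl = R≢∅
  ... | no  _    = nonempty M w

  cluster-connected : ∀ w → Connected G (cluster w)
  cluster-connected w with v ≟ w
  ... | yes refl = R-connected
  ... | no  _    = connected M w

  cluster-touches : ∀ u w → Adj H u w → Touches G (cluster u) (cluster w)
  cluster-touches u w uw with v ≟ u | v ≟ w
  ... | yes refl | yes refl = contradiction refl (adj⇒≢ H uw)
  ... | yes refl | no  _    = R-touches w uw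
  ... | no  _    | yes refl = Touches-sym G (R-touches u (trans (adj-sym H w u) uw))
  ... | no  _    | no  _    = edges⇒ M u w uw

  replaceCluster : InducedMinorModel H G
  replaceCluster = record
    { f         = cluster
    ; nonempty  = cluster-nonempty
    ; disjoint  = λ u w u≢w z z∈u z∈w → disjoint M u w u≢w z (cluster⊆ u z∈u) (cluster⊆ w z∈w)
    ; connected = cluster-connected
    ; edges⇒    = cluster-touches
    ; edges⇐    = λ u w u≢w a b a∈u b∈w → edges⇐ M u w u≢w a b (cluster⊆ u a∈u) (cluster⊆ w b∈w)
    }

  weight-replaceCluster : ∣ R ∣ < ∣ f M v ∣ → weight replaceCluster < weight M
  weight-replaceCluster ∣R∣<∣C∣ = ∑-mono-< _ _ (λ w → p⊆q⇒∣p∣≤∣q∣ (cluster⊆ w)) v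
    (subst (λ S → ∣ S ∣ < ∣ f M v ∣) (sym cluster-v) ∣R∣<∣C∣)

nbhd : (G : Graph) → Subset (size G) → Vertex G → Subset (size G)
nbhd G S v = Vec.tabulate λ u → inS S u ∧ adj G v u

∈nbhd⁻ : (G : Graph) (S : Subset (size G)) (v : Vertex G) {u : Vertex G} → u ∈ nbhd G S v → u ∈ S × Adj G v u
∈nbhd⁻ G S v {u} u∈ = lookup⇒[]= u S (∧-conicalˡ _ _ both) , ∧-conicalʳ _ _ both
  where
  both : inS S u ∧ adj G v u ≡ true
  both = ∈-tabulate⁻ u∈

degIn≡∣nbhd∣ : (G : Graph) (S : Subset (size G)) (v : Vertex G) → degIn G S v ≡ ∣ nbhd G S v ∣
degIn≡∣nbhd∣ G S v = length-filter-allFin (λ u → inS S u ∧ adj G v u)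

deg≡∣adj∣ : (G : Graph) (v : Vertex G) → deg G v ≡ ∣ Vec.tabulate (adj G v) ∣
deg≡∣adj∣ G v = length-filter-allFin (adj G v)

module _ {H G : Graph} (M : InducedMinorModel H G) {v : Vertex H} {x : Vertex G} (x∈C : x ∈ f M v) where

  open BreadthFirstTree G (f M v) (connected M v) x∈C

  Blocked : Vertex G → Set
  Blocked y = Σ (Vertex H) λ w → Adj H v w × ¬ Touches G (f M v - leaf y) (f M w)

  blocked? : ∀ y → Dec (Blocked y)
  blocked? y = any? λ w → adj? H v w ×-dec ¬? (touches? G _ _)

  shrink : ∀ {y} → y ∈ f M v → Adj G x y → ¬ Blocked y → ∃ λ M′ → weight M′ < weight M
  shrink {y} y∈C xy unblocked = M′ , weight-replaceCluster M v R⊆C R≢∅ (leaf-nonCut y∈C xy) spare ∣R∣<∣C∣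
    where
    R⊆C : f M v - leaf y ⊆ f M v
    R⊆C = p─q⊆p _ _
    R≢∅ : Nonempty (f M v - leaf y)
    R≢∅ = x , x∈p∧x≢y⇒x∈p-y x∈C (leaf≢x y∈C xy ∘ sym)
    ∣R∣<∣C∣ : ∣ f M v - leaf y ∣ < ∣ f M v ∣
    ∣R∣<∣C∣ = x∈p⇒∣p-x∣<∣p∣ (leaf∈C y∈C xy)
    spare : ∀ w → Adj H v w → Touches G (f M v - leaf y) (f M w)
    spare w vw = decidable-stable (touches? G _ _) λ ¬touch → unblocked (w , vw , ¬touch)
    M′ : InducedMinorModel H G
    M′ = replaceCluster M v R⊆C R≢∅ (leaf-nonCut y∈C xy) spare

  sole-contact : ∀ y {a b w} → ¬ Touches G (f M v - leaf y) (f M w) →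
    a ∈ f M v → b ∈ f M w → Adj G a b → a ≡ leaf y
  sole-contact y {a} {b} ¬touch a∈C b∈w ab with a ≟ leaf y
  ... | yes a≡ℓ = a≡ℓ
  ... | no  a≢ℓ = contradiction (a , b , x∈p∧x≢y⇒x∈p-y a∈C a≢ℓ , b∈w , ab) ¬touch

  degIn≤deg : (∀ {y} → y ∈ f M v → Adj G x y → Blocked y) → degIn G (f M v) x ≤ deg H v
  degIn≤deg blocked = begin
    degIn G (f M v) x           ≡⟨ degIn≡∣nbhd∣ G (f M v) x ⟩
    ∣ nbhd G (f M v) x ∣        ≤⟨ injection⇒∣p∣≤∣q∣ g (λ y∈N → ∈-tabulate⁺ (g-adj y∈N)) g-injective ⟩
    ∣ Vec.tabulate (adj H v) ∣  ≡⟨ deg≡∣adj∣ H v ⟨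
    deg H v                     ∎
    where
    open ≤-Reasoning
    module _ {y} (y∈N : y ∈ nbhd G (f M v) x) where
      y∈C : y ∈ f M v
      y∈C = proj₁ (∈nbhd⁻ G (f M v) x y∈N)
      xy : Adj G x y
      xy = proj₂ (∈nbhd⁻ G (f M v) x y∈N)
      g : Vertex H
      g = proj₁ (blocked y∈C xy)
      g-adj : Adj H v g
      g-adj = proj₁ (proj₂ (blocked y∈C xy))
      g-untouched : ¬ Touches G (f M v - leaf y) (f M g)
      g-untouched = proj₂ (proj₂ (blocked y∈C xy))
    -- an edge between the clusters of v and of the common w must leave from both leaves
    g-injective : ∀ {y y′} (y∈N : y ∈ nbhd G (f M v) x) (y′∈N : y′ ∈ nbhd G (f M v) x) → g y∈N ≡ g y′∈N → y ≡ y′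
    g-injective {y} {y′} y∈N y′∈N w≡w′ with edges⇒ M v _ (g-adj y∈N)
    ... | a , b , a∈C , b∈w , ab = leaf-injective (y∈C y∈N) (xy y∈N) (y∈C y′∈N) (xy y′∈N)
      (trans (sym (sole-contact y (g-untouched y∈N) a∈C b∈w ab))
             (sole-contact y′ (g-untouched y′∈N) a∈C (subst (λ w → b ∈ f M w) w≡w′ b∈w) ab))

  shrink-or-degIn≤deg : (∃ λ M′ → weight M′ < weight M) ⊎ degIn G (f M v) x ≤ deg H v
  shrink-or-degIn≤deg with any? (λ y → (y ∈? f M v ×-dec adj? G x y) ×-dec ¬? (blocked? y))
  ... | yes (y , (y∈C , xy) , unblocked) = inj₁ (shrink y∈C xy unblocked)
  ... | no  none = inj₂ (degIn≤deg λ y∈C xy →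
          decidable-stable (blocked? _) λ unblocked → none (_ , (y∈C , xy) , unblocked))

≤-foldr-⊔ : ∀ {A : Set} (h : Fin n → A) (a : A → ℕ) i → a (h i) ≤ foldr _⊔_ 0 (map a (tabulate h))
≤-foldr-⊔ h a zero    = m≤m⊔n _ _
≤-foldr-⊔ h a (suc i) = ≤-trans (≤-foldr-⊔ (h ∘ suc) a i) (m≤n⊔m _ _)

deg≤maxDeg : (H : Graph) (v : Vertex H) → deg H v ≤ maxDeg H
deg≤maxDeg H = ≤-foldr-⊔ Function.id (deg H)

module _ {G H : Graph} {d : ℕ} (deg≤d : ∀ v → deg H v ≤ d) where

  Violation : InducedMinorModel H G → Set
  Violation M = Σ (Vertex H) λ v → Σ (Vertex G) λ x → x ∈ f M v × d < degIn G (f M v) x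

  violation? : (M : InducedMinorModel H G) → Dec (Violation M)
  violation? M = any? λ v → any? λ x → x ∈? f M v ×-dec d <?ℕ degIn G (f M v) x

  boundedModel : (M : InducedMinorModel H G) → Acc _<_ (weight M) →
    Σ (InducedMinorModel H G) λ M′ → ∀ v → MaxDegInAtMost G (f M′ v) d
  boundedModel M (acc smaller) with violation? M
  ... | no none = M , λ v x x∈ → ≮⇒≥ λ d<deg → none (v , x , x∈ , d<deg)
  ... | yes (v , x , x∈C , d<deg) with shrink-or-degIn≤deg M x∈C
  ...   | inj₁ (M′ , lighter) = boundedModel M′ (smaller lighter)
  ...   | inj₂ degIn≤deg      = contradiction (≤-trans degIn≤deg (deg≤d v)) (<⇒≱ d<deg)

lemma17 : (G H : Graph) (d : ℕ) → maxDeg H ≡ d → ContainsInducedMinor G H →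
    Σ (InducedMinorModel H G) λ M → ∀ v → MaxDegInAtMost G (f M v) d
lemma17 G H d maxDeg≡d M =
  boundedModel (λ v → subst (deg H v ≤_) maxDeg≡d (deg≤maxDeg H v)) M (<-wellFounded (weight M))
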